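{- Let $G$ be a graph and $k\geq 3$ an integer. Then $$\mu(G^{(k)},x)=x^{(1-\frac{k}{2})|V(G)|+(k-2)|E(G)|}\,\mu(G,x^{\frac{k}{2}}).$$ In particular, $\lambda(G^{(k)})=\lambda(G)^{\frac{2}{k}}$.
   Context: Graphs are finite simple graphs. For a $k$-graph (or graph, $k=2$) $\mathcal{H}$, $\mu(\mathcal{H},x)=\sum_{r\ge0}(-1)^r p(\mathcal{H},r)x^{|V(\mathcal{H})|-kr}$ with $p(\mathcal{H},r)$ the number of sets of $r$ pairwise disjoint edges, and $\lambda(\mathcal{H})$ is the maximum modulus of the zeros of $\mu(\mathcal{H},x)$. The $k$-th power $G^{(k)}$ of a graph $G=(V,E)$ is the $k$-graph with vertex set $V\cup\{v_{e,1},\dots,v_{e,k-2}:e\in E\}$ (all $v_{e,j}$ new and distinct) and edge set $\{e\cup\{v_{e,1},\dots,v_{e,k-2}\}:e\in E\}$. -}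

module Defs where

open import Data.Bool using (Bool; true; false)
open import Data.Nat as ℕ using (ℕ; zero; suc; _∸_)
open import Data.Integer as ℤ using (ℤ; +_; -1ℤ; 0ℤ)
open import Data.Fin using (Fin)
open import Data.Fin.Subset using (Subset; _∩_; ⊥; ∣_∣)
open import Data.Vec as Vec using (Vec; _++_)
import Data.Vec.Properties as VecP
open import Data.List as List using (List; []; _∷_; length; filter; map; upTo)
open import Data.List.Relation.Unary.All using (All)
open import Data.List.Relation.Unary.AllPairs using (AllPairs; allPairs?)
open import Data.List.Relation.Unary.Unique.Propositional using (Unique)
open import Data.Product using (_×_; _,_; proj₁; proj₂)
open import Relation.Binary.PropositionalEquality using (_≡_; _≢_)
open import Relation.Nullary.Decidable using (_×-dec_; isYes; does)
import Data.Bool.Properties as BoolP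
import Data.Fin.Properties as FinP

record Hypergraph : Set where
  constructor hypergraph
  field
    nV    : ℕ
    edges : List (Subset nV)
open Hypergraph public

IsKGraph : ℕ → Hypergraph → Set
IsKGraph k H = All (λ e → ∣ e ∣ ≡ k) (edges H) × Unique (edges H)

IsGraph : Hypergraph → Set
IsGraph = IsKGraph 2

nE : Hypergraph → ℕ
nE H = length (edges H)

Disjoint : ∀ {n} → Subset n → Subset n → Set
Disjoint p q = p ∩ q ≡ ⊥

sublists : ∀ {A : Set} → List A → List (List A)
sublists []       = [] ∷ []
sublists (x ∷ xs) = sublists xs List.++ map (x ∷_) (sublists xs)

p : Hypergraph → ℕ → ℕ
p H r = length (filter (λ s → (length s ℕ.≟ r)
                               ×-dec allPairs? (λ a b → VecP.≡-dec BoolP._≟_ (a ∩ b) ⊥) s)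
                       (sublists (edges H)))

-- Laurent polynomials with integer coefficients, as finite lists of
-- terms (coefficient , exponent).  coeff P e = coefficient of the
-- monomial with exponent e.

Term : Set
Term = ℤ × ℤ

coeff : List Term → ℤ → ℤ
coeff P e = List.foldr ℤ._+_ 0ℤ (map proj₁ (filter (λ t → proj₂ t ℤ.≟ e) P))

-- matching polynomial of a k-graph H (as a polynomial in x):
-- μ(H,x) = Σ_r (-1)^r p(H,r) x^{|V(H)| - k r}, r = 0 .. |E(H)|
-- (p(H,r) = 0 for r > |E(H)|).
μ : ℕ → Hypergraph → List Term
μ k H = map (λ r → ((-1ℤ ℤ.^ r) ℤ.* (+ p H r)) , ((+ nV H) ℤ.- (+ (k ℕ.* r))))
            (upTo (suc (nE H)))

-- Elements of ℤ[x^{±1/2}] are represented as term lists whose exponent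
-- field stores TWICE the actual exponent ("doubled exponents").

embedHalf : List Term → List Term
embedHalf = map (λ t → proj₁ t , (+ 2) ℤ.* proj₂ t)

-- substitute x ↦ x^{k/2}: x^a ↦ x^{a k / 2}, doubled exponent a·k
substHalf : ℕ → List Term → List Term
substHalf k = map (λ t → proj₁ t , proj₂ t ℤ.* (+ k))

mulMonoHalf : ℤ → List Term → List Term
mulMonoHalf d = map (λ t → proj₁ t , d ℤ.+ proj₂ t)

-- k-th power G^{(k)}: vertex set V ∪ {v_{e,j} : e ∈ E, 1 ≤ j ≤ k-2},
-- realised as Fin (|V| + |E|·(k-2)); the new vertices of the i-th edge
-- form the i-th block of length k-2.

newBlock : (k m : ℕ) → Fin m → Subset (m ℕ.* (k ∸ 2))
newBlock k m i = Vec.concat (Vec.tabulate (λ j → Vec.replicate (k ∸ 2) (isYes (j FinP.≟ i))))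

power : Hypergraph → ℕ → Hypergraph
power G k = hypergraph (nV G ℕ.+ nE G ℕ.* (k ∸ 2))
                       (List.tabulate (λ i → List.lookup (edges G) i ++ newBlock k (nE G) i))

{-# OPTIONS --safe #-}
-- Each edge of G^(k) is an edge of G padded with its own block of k − 2 new vertices.
-- These blocks are pairwise disjoint, so a set of edges of G^(k) is pairwise disjoint
-- exactly when the underlying edges of G are, and p(G^(k), r) = p(G, r).  The two sides
-- then agree term by term; in doubled exponents the r-th term needs only the identity
-- 2(|V| + (k−2)|E| − kr) = (2−k)|V| + 2(k−2)|E| + (|V| − 2r)k.
module Submission where

open import Defs
open import Data.Nat using (ℕ; _≤_)
open import Data.Integer using (ℤ; +_; _-_; _*_; _+_)
open import Relation.Binary.PropositionalEquality using (_≡_)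

open import Data.Bool using (Bool; true; false; _∧_)
open import Data.Fin as Fin using (Fin)
import Data.Fin.Properties as Fin
open import Data.Fin.Subset as Subset using (Subset; _∩_)
import Data.Integer as ℤ
open import Data.Integer.Properties using (pos-+; pos-*)
open import Data.Integer.Tactic.RingSolver using (solve-∀)
open import Data.List as List using (List; []; _∷_; length; filter; map; upTo)
import Data.List.Properties as List
open import Data.List.Relation.Binary.Sublist.Propositional using (_⊆_; []; _∷_; _∷ʳ_)
open import Data.List.Relation.Binary.Sublist.Propositional.Properties using (All-resp-⊆)
open import Data.List.Relation.Unary.All as All using (All; []; _∷_)
import Data.List.Relation.Unary.All.Properties as All
open import Data.List.Relation.Unary.AllPairs as AllPairs using (AllPairs; []; _∷_; allPairs?)
import Data.List.Relation.Unary.AllPairs.Properties as AllPairs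
open import Data.Nat as ℕ using (zero; suc; s≤s; _∸_)
open import Data.Product using (_×_; _,_; proj₁; proj₂; uncurry)
open import Data.Vec as Vec using (Vec; _++_)
import Data.Vec.Properties as Vec
open import Function using (_∘_; _on_; _⇔_; mk⇔)
open import Relation.Binary.PropositionalEquality using (refl; sym; trans; cong; cong₂; _≢_; module ≡-Reasoning)
open import Relation.Nullary.Decidable using (Dec; does; isYes; yes; no; _×-dec_; does-⇔; isYes≗does; dec-false)
import Data.Bool.Properties as Bool

replicate-+ : ∀ {A : Set} m {n} (x : A) → Vec.replicate (m ℕ.+ n) x ≡ Vec.replicate m x ++ Vec.replicate n x
replicate-+ zero    x = refl
replicate-+ (suc m) x = cong (x Vec.∷_) (replicate-+ m x)

module _ {n w : ℕ} (a b : Subset n) (A B : Subset w) where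

  ∩-++ : (a ++ A) ∩ (b ++ B) ≡ (a ∩ b) ++ (A ∩ B)
  ∩-++ = Vec.zipWith-++ _∧_ a A b B

  Disjoint-++⁺ : Disjoint a b → Disjoint A B → Disjoint (a ++ A) (b ++ B)
  Disjoint-++⁺ ab AB = trans ∩-++ (trans (cong₂ _++_ ab AB) (sym (replicate-+ n false)))

  Disjoint-++⁻ˡ : Disjoint (a ++ A) (b ++ B) → Disjoint a b
  Disjoint-++⁻ˡ aAbB = Vec.++-injectiveˡ (a ∩ b) Subset.⊥
    (trans (sym ∩-++) (trans aAbB (replicate-+ n false)))

blocks-disjoint : ∀ {m} w (c d : Fin m → Bool) → (∀ j → c j ∧ d j ≡ false) →
  Disjoint (Vec.concat (Vec.tabulate (Vec.replicate w ∘ c)))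
           (Vec.concat (Vec.tabulate (Vec.replicate w ∘ d)))
blocks-disjoint {zero}  w c d cd = refl
blocks-disjoint {suc m} w c d cd =
  Disjoint-++⁺ (Vec.replicate w (c Fin.zero)) (Vec.replicate w (d Fin.zero)) _ _
    (trans (Vec.zipWith-replicate _∧_ (c Fin.zero) (d Fin.zero)) (cong (Vec.replicate w) (cd Fin.zero)))
    (blocks-disjoint w (c ∘ Fin.suc) (d ∘ Fin.suc) (cd ∘ Fin.suc))

isYes-≟-∧ : ∀ {m} {i i′ : Fin m} → i ≢ i′ → ∀ j → isYes (j Fin.≟ i) ∧ isYes (j Fin.≟ i′) ≡ false
isYes-≟-∧ {i = i} {i′} i≢i′ j with j Fin.≟ i
... | no  _    = refl
... | yes refl = trans (isYes≗does (j Fin.≟ i′)) (dec-false (j Fin.≟ i′) i≢i′)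

newBlock-disjoint : ∀ k m {i i′ : Fin m} → i ≢ i′ → Disjoint (newBlock k m i) (newBlock k m i′)
newBlock-disjoint k m i≢i′ = blocks-disjoint (k ∸ 2) _ _ (isYes-≟-∧ i≢i′)

module _ {A : Set} where

  sublists-⊆ : (xs : List A) → All (_⊆ xs) (sublists xs)
  sublists-⊆ []       = [] ∷ []
  sublists-⊆ (x ∷ xs) = All.++⁺ (All.map (x ∷ʳ_) (sublists-⊆ xs))
                                (All.map⁺ (All.map (refl ∷_) (sublists-⊆ xs)))

  AllPairs-resp-⊇ : ∀ {R : A → A → Set} {xs ys} → AllPairs R xs → ys ⊆ xs → AllPairs R ys
  AllPairs-resp-⊇ []       []         = []
  AllPairs-resp-⊇ (_ ∷ rs) (_ ∷ʳ τ)   = AllPairs-resp-⊇ rs τ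
  AllPairs-resp-⊇ (r ∷ rs) (refl ∷ τ) = All-resp-⊆ τ r ∷ AllPairs-resp-⊇ rs τ

  sublists-map : ∀ {B : Set} (f : A → B) (xs : List A) → sublists (map f xs) ≡ map (map f) (sublists xs)
  sublists-map f []       = refl
  sublists-map f (x ∷ xs) = begin
    sublists (map f xs) List.++ map (f x ∷_) (sublists (map f xs))
      ≡⟨ cong (λ ss → ss List.++ map (f x ∷_) ss) (sublists-map f xs) ⟩
    map (map f) (sublists xs) List.++ map (f x ∷_) (map (map f) (sublists xs))
      ≡⟨ cong (map (map f) (sublists xs) List.++_) (trans (sym (List.map-∘ (sublists xs))) (List.map-∘ (sublists xs))) ⟩
    map (map f) (sublists xs) List.++ map (map f) (map (x ∷_) (sublists xs))
      ≡⟨ sym (List.map-++ (map f) (sublists xs) _) ⟩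
    map (map f) (sublists (x ∷ xs)) ∎
    where open ≡-Reasoning

length-filter-map-cong : ∀ {A B C : Set} {P : B → Set} {Q : C → Set}
  (P? : ∀ y → Dec (P y)) (Q? : ∀ z → Dec (Q z)) {f : A → B} {g : A → C} {xs : List A} →
  All (λ x → P (f x) ⇔ Q (g x)) xs → length (filter P? (map f xs)) ≡ length (filter Q? (map g xs))
length-filter-map-cong P? Q? [] = refl
length-filter-map-cong P? Q? {f} {g} {x ∷ _} (P⇔Q ∷ rest)
  with does (P? (f x)) | does (Q? (g x)) | does-⇔ P⇔Q (P? (f x)) (Q? (g x))
... | true  | .true  | refl = cong suc (length-filter-map-cong P? Q? rest)
... | false | .false | refl = length-filter-map-cong P? Q? rest

IsMatching : ∀ {n} → ℕ → List (Subset n) → Set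
IsMatching r es = length es ≡ r × AllPairs Disjoint es

-- Literally the test in the definition of p, so p H r unfolds to a count of matchings.
isMatching? : ∀ {n} r (es : List (Subset n)) → Dec (IsMatching r es)
isMatching? r es = (length es ℕ.≟ r) ×-dec allPairs? (λ a b → Vec.≡-dec Bool._≟_ (a ∩ b) Subset.⊥) es

IsMatching-++⇔ : ∀ {n w} r {es : List (Subset n × Subset w)} → AllPairs (Disjoint on proj₂) es →
  IsMatching r (map proj₁ es) ⇔ IsMatching r (map (uncurry _++_) es)
IsMatching-++⇔ r {es} pads = mk⇔
  (λ (len , disj) → trans (length-map-map proj₁) len ,
     AllPairs.map⁺ (AllPairs.zipWith (λ (ab , AB) → Disjoint-++⁺ _ _ _ _ ab AB) (AllPairs.map⁻ disj , pads)))
  (λ (len , disj) → trans (length-map-map (uncurry _++_)) len ,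
     AllPairs.map⁺ (AllPairs.map (Disjoint-++⁻ˡ _ _ _ _) (AllPairs.map⁻ disj)))
  where
  length-map-map : ∀ {B C : Set} (f : _ → B) {g : _ → C} → length (map g es) ≡ length (map f es)
  length-map-map f {g} = trans (List.length-map g es) (sym (List.length-map f es))

p-++-disjoint : ∀ {n w} r (es : List (Subset n × Subset w)) → AllPairs (Disjoint on proj₂) es →
  p (hypergraph (n ℕ.+ w) (map (uncurry _++_) es)) r ≡ p (hypergraph n (map proj₁ es)) r
p-++-disjoint r es pads = begin
  length (filter (isMatching? r) (sublists (map (uncurry _++_) es)))
    ≡⟨ cong (length ∘ filter (isMatching? r)) (sublists-map _ es) ⟩
  length (filter (isMatching? r) (map (map (uncurry _++_)) (sublists es)))
    ≡⟨ length-filter-map-cong (isMatching? r) (isMatching? r) IsMatching-++⇔-sublists ⟨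
  length (filter (isMatching? r) (map (map proj₁) (sublists es)))
    ≡⟨ cong (length ∘ filter (isMatching? r)) (sublists-map proj₁ es) ⟨
  length (filter (isMatching? r) (sublists (map proj₁ es))) ∎
  where
  open ≡-Reasoning
  IsMatching-++⇔-sublists : All (λ s → IsMatching r (map proj₁ s) ⇔ IsMatching r (map (uncurry _++_) s)) (sublists es)
  IsMatching-++⇔-sublists = All.map (IsMatching-++⇔ r ∘ AllPairs-resp-⊇ pads) (sublists-⊆ es)

p-power : ∀ G k r → p (power G k) r ≡ p G r
p-power G k r = begin
  p (power G k) r
    ≡⟨ cong (λ es → p (hypergraph _ es) r) (List.map-tabulate block (uncurry _++_)) ⟨
  p (hypergraph _ (map (uncurry _++_) blocks)) r
    ≡⟨ p-++-disjoint r blocks (AllPairs.tabulate⁺ (newBlock-disjoint k (nE G))) ⟩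
  p (hypergraph (nV G) (map proj₁ blocks)) r
    ≡⟨ cong (λ es → p (hypergraph (nV G) es) r) (trans (List.map-tabulate block proj₁) (List.tabulate-lookup (edges G))) ⟩
  p G r ∎
  where
  open ≡-Reasoning
  block : Fin (nE G) → Subset (nV G) × Subset (nE G ℕ.* (k ∸ 2))
  block i = List.lookup (edges G) i , newBlock k (nE G) i
  blocks = List.tabulate block

degreeShift : (k V E : ℕ) → ℤ
degreeShift k V E = ((+ 2) - (+ k)) * (+ V) + (+ 2) * ((+ k) - (+ 2)) * (+ E)

exponent-identity : ∀ (v m j r : ℤ) →
  (+ 2) * ((v + m * j) - (+ 2 + j) * r)
    ≡ ((+ 2 - (+ 2 + j)) * v + (+ 2) * ((+ 2 + j) - (+ 2)) * m) + (v - (+ 2) * r) * (+ 2 + j)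
exponent-identity = solve-∀

power-exponent : ∀ V E j r → let k = 2 ℕ.+ j in
  (+ 2) * ((+ (V ℕ.+ E ℕ.* j)) - (+ (k ℕ.* r))) ≡ degreeShift k V E + ((+ V) - (+ (2 ℕ.* r))) * (+ k)
power-exponent V E j r = begin
  (+ 2) * ((+ (V ℕ.+ E ℕ.* j)) - (+ ((2 ℕ.+ j) ℕ.* r)))
    ≡⟨ cong₂ (λ a b → (+ 2) * (a - b)) (trans (pos-+ V (E ℕ.* j)) (cong (λ z → + V + z) (pos-* E j))) (pos-* (2 ℕ.+ j) r) ⟩
  (+ 2) * ((+ V + + E * + j) - + (2 ℕ.+ j) * + r)
    ≡⟨ exponent-identity (+ V) (+ E) (+ j) (+ r) ⟩
  degreeShift (2 ℕ.+ j) V E + (+ V - + 2 * + r) * + (2 ℕ.+ j)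
    ≡⟨ cong (λ b → degreeShift (2 ℕ.+ j) V E + (+ V - b) * + (2 ℕ.+ j)) (pos-* 2 r) ⟨
  degreeShift (2 ℕ.+ j) V E + ((+ V) - (+ (2 ℕ.* r))) * (+ (2 ℕ.+ j)) ∎
  where open ≡-Reasoning

μ-power : ∀ G j → let k = 2 ℕ.+ j in
  embedHalf (μ k (power G k)) ≡ mulMonoHalf (degreeShift k (nV G) (nE G)) (substHalf k (μ 2 G))
μ-power G j = begin
  embedHalf (μ k (power G k))
    ≡⟨ List.map-∘ (upTo (suc (nE (power G k)))) ⟨
  map powerTerm (upTo (suc (nE (power G k))))
    ≡⟨ cong (λ m → map powerTerm (upTo (suc m))) (List.length-tabulate _) ⟩
  map powerTerm (upTo (suc (nE G)))
    ≡⟨ List.map-cong powerTerm≡graphTerm (upTo (suc (nE G))) ⟩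
  map graphTerm (upTo (suc (nE G)))
    ≡⟨ trans (List.map-∘ (upTo (suc (nE G)))) (cong (map _) (List.map-∘ (upTo (suc (nE G))))) ⟩
  mulMonoHalf (degreeShift k (nV G) (nE G)) (substHalf k (μ 2 G)) ∎
  where
  open ≡-Reasoning
  k = 2 ℕ.+ j
  sign : ℕ → ℤ
  sign r = ℤ.-1ℤ ℤ.^ r
  powerTerm graphTerm : ℕ → Term
  powerTerm r = sign r * (+ p (power G k) r) , (+ 2) * ((+ nV (power G k)) - (+ (k ℕ.* r)))
  graphTerm r = sign r * (+ p G r) , degreeShift k (nV G) (nE G) + ((+ nV G) - (+ (2 ℕ.* r))) * (+ k)
  powerTerm≡graphTerm : ∀ r → powerTerm r ≡ graphTerm r
  powerTerm≡graphTerm r = cong₂ _,_ (cong (λ q → sign r * + q) (p-power G k r)) (power-exponent (nV G) (nE G) j r)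

lemma4p8 : (G : Hypergraph) → IsGraph G → (k : ℕ) → 3 ≤ k →
    (e : ℤ) →
    coeff (embedHalf (μ k (power G k))) e
      ≡ coeff (mulMonoHalf (((+ 2) - (+ k)) * (+ nV G) + (+ 2) * ((+ k) - (+ 2)) * (+ nE G))
                           (substHalf k (μ 2 G))) e
lemma4p8 G _ (suc (suc j)) (s≤s (s≤s _)) e = cong (λ P → coeff P e) (μ-power G j)
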